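{- Let $B$ be a $\wedge_d$-OBDD obeying a linear order $\pi$ (containing $\mathsf{var}(B)$), and let ${\bf g}$ be an assignment whose domain is a prefix of $\pi$. Then: (1) if $u$ is a complete decision node of $B[{\bf g}]$ and $v$ is a decision node reachable from $u$ in $B[{\bf g}]$, then $v$ is also complete; in other words, $B[{\bf g}]_u$ is a $\wedge_d$-OBDD; (2) for any two distinct $u_1,u_2\in L({\bf g})$, $\mathsf{var}(B[{\bf g}]_{u_1})\cap\mathsf{var}(B[{\bf g}]_{u_2})=\emptyset$; (3) the union $T({\bf g})$ of all incomplete paths of $B[{\bf g}]$ ending with nodes of $L({\bf g})$ is a rooted tree.
   Context: A $\wedge_d$-FBDD is a DAG $B$ with a single source and two sinks labelled ${\bf 0}$, ${\bf 1}$; each non-sink node has two children and is either a conjunction node or a decision node labelled by a variable whose outgoing edges are labelled $0$ and $1$. For a node $u$ of a DAG $D$, $D_u$ is the sub-DAG of $D$ induced by the nodes reachable from $u$ (with the same labels), and $\mathsf{var}(D_u)$ is the set of variables labelling decision nodes of $D_u$. Requirements: for every conjunction node with children $u_0,u_1$, $\mathsf{var}(B_{u_0})\cap\mathsf{var}(B_{u_1})=\emptyset$; no directed path has two decision nodes with the same label. $B$ is a $\wedge_d$-OBDD obeying a linear order $\pi$ of a superset of $\mathsf{var}(B)$ if along every directed path decision-node labels appear in increasing $\pi$-order. An assignment is a map from a set of variables to $\{0,1\}$. The alignment $B[{\bf g}]$ is obtained from $B$ by deleting, for each decision node labelled by some $x\in\mathsf{var}({\bf g})$, its outgoing edge labelled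 $1-{\bf g}(x)$, and then deleting all nodes not reachable from the source. A decision node of $B[{\bf g}]$ is incomplete if it has only one outgoing edge in $B[{\bf g}]$, and complete otherwise. An incomplete path is a maximal directed path of $B[{\bf g}]$ starting at the source all of whose decision nodes except possibly the last node are incomplete; such a path ends at a sink or at a complete decision node. $L({\bf g})$ is the set of decision nodes that are final nodes of incomplete paths (equivalently, the complete decision nodes $w$ reachable from the source by a path on which all decision nodes other than $w$ are incomplete). -}

module Defs where

open import Data.Nat using (ℕ; _≤_)
open import Data.Fin using (Fin; _<_)
open import Data.Bool using (Bool; true; false)
open import Data.Maybe using (Maybe; just; nothing)
open import Data.List using (List; length; lookup; take)
open import Data.List.Membership.Propositional using (_∈_)
open import Data.List.Relation.Unary.Unique.Propositional using (Unique)
open import Data.Product using (Σ; ∃; ∃-syntax; _×_; proj₁)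
open import Data.Sum using (_⊎_)
open import Data.Unit using (⊤)
open import Data.Empty using (⊥)
open import Relation.Nullary using (¬_)
open import Relation.Binary.PropositionalEquality using (_≡_; _≢_)

Var : Set
Var = ℕ

data Label : Set where
  sink : Bool → Label
  conj : Label
  dec  : Var → Label

-- A finite labelled DAG skeleton: nodes are Fin size; every non-sink node u
-- has two outgoing edges (u , false) and (u , true) leading to child u false /
-- child u true.  For a decision node, edge (u , b) is the edge labelled b.
-- (child is irrelevant for sinks: edges out of sinks never exist, see Kept.)
record Diagram : Set where
  field
    size   : ℕ
    label  : Fin size → Label
    child  : Fin size → Bool → Fin size
    source : Fin size

Node : Diagram → Set
Node B = Fin (Diagram.size B)

Assignment : Set
Assignment = Var → Maybe Bool

∅ : Assignment
∅ = λ _ → nothing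

InDom : Assignment → Var → Set
InDom g x = ∃[ b ] (g x ≡ just b)

Before : List Var → Var → Var → Set
Before π x y = ∃[ i ] ∃[ j ] (i < j × lookup π i ≡ x × lookup π j ≡ y)

DomIsPrefix : List Var → Assignment → Set
DomIsPrefix π g =
  ∃[ k ] (k ≤ length π × (∀ x → (InDom g x → x ∈ take k π) × (x ∈ take k π → InDom g x)))

module _ (B : Diagram) where
  open Diagram B

  data Walk : Node B → Node B → Set where
    []   : ∀ {u} → Walk u u
    step : ∀ {v} (u : Node B) (b : Bool) → Walk (child u b) v → Walk u v

  AllEdges : (Node B → Bool → Set) → ∀ {u v} → Walk u v → Set
  AllEdges P []             = ⊤
  AllEdges P (step u b w)   = P u b × AllEdges P w

  EdgeOn : Node B → Bool → ∀ {u v} → Walk u v → Set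
  EdgeOn a c []           = ⊥
  EdgeOn a c (step u b w) = (u ≡ a × b ≡ c) ⊎ EdgeOn a c w

  NodeOn : Node B → ∀ {u v} → Walk u v → Set
  NodeOn a {u} []     = a ≡ u
  NodeOn a (step u b w) = a ≡ u ⊎ NodeOn a w

  -- Edge (u , b) is present in the alignment B[g] (before removing
  -- unreachable nodes): u is a conjunction node, or a decision node labelled x
  -- with x ∉ dom g or g x = b.  Kept ∅ is the edge relation of B itself.
  Kept : Assignment → Node B → Bool → Set
  Kept g u b = label u ≡ conj ⊎ ∃[ x ] (label u ≡ dec x × (g x ≡ nothing ⊎ g x ≡ just b))

  Path : Assignment → Node B → Node B → Set
  Path g u v = Σ (Walk u v) (AllEdges (Kept g))

  Path⁺ : Assignment → Node B → Node B → Set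
  Path⁺ g u v = ∃[ b ] (Kept g u b × Path g (child u b) v)

  IsDec : Node B → Set
  IsDec u = ∃[ x ] (label u ≡ dec x)

  -- Nodes of B[g]: those reachable from the source.
  InAlign : Assignment → Node B → Set
  InAlign g v = Path g source v

  Complete : Assignment → Node B → Set
  Complete g u = ∃[ x ] (label u ≡ dec x × g x ≡ nothing)

  Incomplete : Assignment → Node B → Set
  Incomplete g u = ∃[ x ] (label u ≡ dec x × InDom g x)

  VarOf : Assignment → Node B → Var → Set
  VarOf g u x = ∃[ v ] (Path g u v × label v ≡ dec x)

  IncEdge : Assignment → Node B → Bool → Set
  IncEdge g u b = Kept g u b × (IsDec u → Incomplete g u)

  -- Paths whose decision nodes, except possibly the last node, are incomplete.
  IncPath : Assignment → Node B → Node B → Set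
  IncPath g u w = Σ (Walk u w) (AllEdges (IncEdge g))

  InL : Assignment → Node B → Set
  InL g w = Complete g w × IncPath g source w

  TEdge : Assignment → Node B → Bool → Set
  TEdge g a c = ∃[ w ] (InL g w × Σ (IncPath g source w) (λ p → EdgeOn a c (proj₁ p)))

  TNode : Assignment → Node B → Set
  TNode g a = ∃[ w ] (InL g w × Σ (IncPath g source w) (λ p → NodeOn a (proj₁ p)))

  -- T(g) is a tree rooted at the source: every node of T(g) is reached from
  -- the source by exactly one walk using only edges of T(g).
  IsRootedTree : Assignment → Set
  IsRootedTree g =
    ∀ v → TNode g v →
      Σ (Walk source v) (AllEdges (TEdge g))
      × (∀ (p q : Walk source v) → AllEdges (TEdge g) p → AllEdges (TEdge g) q → p ≡ q)

  InDeg0 : Node B → Set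
  InDeg0 v = ∀ u b → Kept ∅ u b → child u b ≢ v

  record IsAndFBDD : Set where
    field
      source-indeg0 : InDeg0 source
      source-unique : ∀ v → InDeg0 v → v ≡ source
      acyclic       : ∀ u → ¬ Path⁺ ∅ u u
      sink-exists   : ∀ b → ∃[ u ] (label u ≡ sink b)
      sink-unique   : ∀ u v b → label u ≡ sink b → label v ≡ sink b → u ≡ v
      decomposable  : ∀ u → label u ≡ conj → ∀ x →
                        VarOf ∅ (child u false) x → VarOf ∅ (child u true) x → ⊥
      read-once     : ∀ u v x → label u ≡ dec x → label v ≡ dec x → ¬ Path⁺ ∅ u v

  record Obeys (π : List Var) : Set where
    field
      π-linear  : Unique π
      π-covers  : ∀ u x → label u ≡ dec x → x ∈ π
      ordered   : ∀ u v x y → label u ≡ dec x → label v ≡ dec y → Path⁺ ∅ u v → Before π x y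

-- (1) A complete node is labelled by a variable outside the prefix dom g, and
-- every variable below it comes later in π, so it is outside dom g as well.
-- (2), (3) At a decision node an incomplete path has only one way to go, so two
-- incomplete paths can only part at a conjunction node, whose two sides share
-- no variable. Hence two incomplete paths from a common node to complete nodes
-- whose subdiagrams share a variable are equal; this separates distinct nodes
-- of L(g) and makes the walk inside T(g) to any of its nodes unique.
module Submission where

open import Defs
open import Axiom.UniquenessOfIdentityProofs using (module Decidable⇒UIP)
open import Data.Bool using (Bool; true; false)
open import Data.Empty using (⊥; ⊥-elim)
open import Data.Fin using (Fin; toℕ; _≟_) renaming (zero to fzero; suc to fsuc)
open import Data.List using (List; []; _∷_; length; lookup; take)
open import Data.List.Membership.Propositional using (_∈_)
open import Data.List.Membership.Propositional.Properties using (∈-lookup)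
open import Data.List.Relation.Unary.All as All using ()
open import Data.List.Relation.Unary.AllPairs using (_∷_)
open import Data.List.Relation.Unary.Any using (here; there)
open import Data.List.Relation.Unary.Unique.Propositional using (Unique)
open import Data.Maybe using (just; nothing)
open import Data.Nat as ℕ using (suc; _+_; z≤n; s≤s)
open import Data.Nat.Properties using (<-trans; m≢1+n+m)
open import Data.Product using (Σ; _×_; _,_; proj₁; proj₂)
open import Data.Product.Properties using (,-injectiveʳ-UIP)
open import Data.Sum using (inj₁; inj₂)
open import Data.Unit using (tt)
open import Relation.Nullary using (¬_)
open import Relation.Binary.PropositionalEquality
  using (_≡_; _≢_; refl; sym; trans; cong)

lookup-∈-take : ∀ {A : Set} (xs : List A) {k} (i : Fin (length xs)) →
                toℕ i ℕ.< k → lookup xs i ∈ take k xs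
lookup-∈-take (x ∷ xs) {suc k} fzero    _         = here refl
lookup-∈-take (x ∷ xs) {suc k} (fsuc i) (s≤s i<k) = there (lookup-∈-take xs i i<k)

lookup-∈-take⇒< : ∀ {A : Set} {xs : List A} → Unique xs → ∀ {k} (i : Fin (length xs)) →
                  lookup xs i ∈ take k xs → toℕ i ℕ.< k
lookup-∈-take⇒< {xs = _ ∷ _}  _          {suc k} fzero    _          = s≤s z≤n
lookup-∈-take⇒< {xs = _ ∷ xs} (x∉ ∷ _)   {suc k} (fsuc i) (here eq)  =
  ⊥-elim (All.lookup x∉ (∈-lookup {xs = xs} i) (sym eq))
lookup-∈-take⇒< {xs = _ ∷ _}  (_ ∷ uxs)  {suc k} (fsuc i) (there i∈) =
  s≤s (lookup-∈-take⇒< uxs i i∈)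

dom-downClosed : ∀ {π g x y} → Unique π → DomIsPrefix π g →
                 Before π x y → InDom g y → InDom g x
dom-downClosed {π} uπ (k , _ , dom⇔) (i , j , i<j , refl , refl) y∈dom =
  proj₂ (dom⇔ _) (lookup-∈-take π i (<-trans i<j j<k))
  where j<k = lookup-∈-take⇒< uπ j (proj₁ (dom⇔ _) y∈dom)

module _ {B : Diagram} where

  _++ᵂ_ : ∀ {u v w} → Walk B u v → Walk B v w → Walk B u w
  []         ++ᵂ q = q
  step u b p ++ᵂ q = step u b (p ++ᵂ q)

  AllEdges-++ : ∀ {P u v w} (p : Walk B u v) {q : Walk B v w} →
                AllEdges B P p → AllEdges B P q → AllEdges B P (p ++ᵂ q)
  AllEdges-++ []           _          Pq = Pq
  AllEdges-++ (step u b p) (Pub , Pp) Pq = Pub , AllEdges-++ p Pp Pq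

  AllEdges-map : ∀ {P Q} → (∀ {u b} → P u b → Q u b) →
                 ∀ {u v} (p : Walk B u v) → AllEdges B P p → AllEdges B Q p
  AllEdges-map f []           _          = tt
  AllEdges-map f (step u b p) (Pub , Pp) = f Pub , AllEdges-map f p Pp

  EdgeOn⇒AllEdges : ∀ {P a c u v} (p : Walk B u v) → EdgeOn B a c p → AllEdges B P p → P a c
  EdgeOn⇒AllEdges (step u b p) (inj₁ (refl , refl)) (Pub , _) = Pub
  EdgeOn⇒AllEdges (step u b p) (inj₂ e)             (_ , Pp)  = EdgeOn⇒AllEdges p e Pp

  walkLength : ∀ {u v} → Walk B u v → ℕ.ℕ
  walkLength []           = 0
  walkLength (step _ _ p) = suc (walkLength p)

  walkLength-++ : ∀ {u v w} (p : Walk B u v) (q : Walk B v w) →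
                  walkLength (p ++ᵂ q) ≡ walkLength p + walkLength q
  walkLength-++ []           q = refl
  walkLength-++ (step u b p) q = cong suc (walkLength-++ p q)

  step-injective : ∀ {u b w} {p q : Walk B (Diagram.child B u b) w} → step u b p ≡ step u b q → p ≡ q
  step-injective refl = refl

  ++ᵂ-cancelʳ : ∀ {u v w} (p q : Walk B u v) (s : Walk B v w) → p ++ᵂ s ≡ q ++ᵂ s → p ≡ q
  ++ᵂ-cancelʳ []           []           s eq = refl
  ++ᵂ-cancelʳ []           (step u b q) s eq =
    ⊥-elim (m≢1+n+m (walkLength s) (trans (cong walkLength eq) (cong suc (walkLength-++ q s))))
  ++ᵂ-cancelʳ (step u b p) []           s eq =
    ⊥-elim (m≢1+n+m (walkLength s) (trans (cong walkLength (sym eq)) (cong suc (walkLength-++ p s))))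
  ++ᵂ-cancelʳ (step u false p) (step u false q) s eq = cong (step u false) (++ᵂ-cancelʳ p q s (step-injective eq))
  ++ᵂ-cancelʳ (step u true p)  (step u true q)  s eq = cong (step u true) (++ᵂ-cancelʳ p q s (step-injective eq))
  ++ᵂ-cancelʳ (step u false p) (step u true q)  s ()
  ++ᵂ-cancelʳ (step u true p)  (step u false q) s ()

  splitAt-NodeOn : ∀ {P a u w} (p : Walk B u w) → NodeOn B a p → AllEdges B P p →
                   Σ (Walk B u a) (AllEdges B (λ c b → EdgeOn B c b p)) × Σ (Walk B a w) (AllEdges B P)
  splitAt-NodeOn []           refl        Pp       = ([] , tt) , ([] , tt)
  splitAt-NodeOn (step u b p) (inj₁ refl) Pp       = ([] , tt) , (step u b p , Pp)
  splitAt-NodeOn (step u b p) (inj₂ a∈p) (_ , Pp) with splitAt-NodeOn p a∈p Pp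
  ... | (r , r⊆p) , s = (step u b r , inj₁ (refl , refl) , AllEdges-map inj₂ r r⊆p) , s

module Alignment (B : Diagram) (g : Assignment) where
  open Diagram B

  Kept⇒Kept∅ : ∀ {u b} → Kept B g u b → Kept B ∅ u b
  Kept⇒Kept∅ (inj₁ u-conj)       = inj₁ u-conj
  Kept⇒Kept∅ (inj₂ (x , ux , _)) = inj₂ (x , ux , inj₁ refl)

  Path⇒Path∅ : ∀ {u v} → Path B g u v → Path B ∅ u v
  Path⇒Path∅ (p , kept) = p , AllEdges-map Kept⇒Kept∅ p kept

  IncPath⇒Path∅ : ∀ {u v} → IncPath B g u v → Path B ∅ u v
  IncPath⇒Path∅ (p , inc) = p , AllEdges-map (λ e → Kept⇒Kept∅ (proj₁ e)) p inc

  VarOf⇒VarOf∅ : ∀ {u x} → VarOf B g u x → VarOf B ∅ u x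
  VarOf⇒VarOf∅ (v , p , vx) = v , Path⇒Path∅ p , vx

  VarOf∅-extend : ∀ {u v x} → Path B ∅ u v → VarOf B ∅ v x → VarOf B ∅ u x
  VarOf∅-extend (p , kp) (w , (q , kq) , wx) = w , (p ++ᵂ q , AllEdges-++ p kp kq) , wx

  complete⇒¬IncEdge : ∀ {u b} → Complete B g u → ¬ IncEdge B g u b
  complete⇒¬IncEdge (x , ux , gx) (_ , inc) with inc (x , ux)
  ... | y , uy , c , gy with trans (sym ux) uy
  ... | refl with trans (sym gx) gy
  ... | ()

  kept-bit : ∀ {u x c b} → label u ≡ dec x → g x ≡ just c → Kept B g u b → c ≡ b
  kept-bit ux gx (inj₁ u-conj) with trans (sym ux) u-conj
  ... | ()
  kept-bit ux gx (inj₂ (y , uy , gy)) with trans (sym ux) uy | gy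
  ... | refl | inj₁ gy≡nothing with trans (sym gx) gy≡nothing
  ...   | ()
  kept-bit ux gx (inj₂ (y , uy , gy)) | refl | inj₂ gy≡just with trans (sym gx) gy≡just
  ...   | refl = refl

  IncEdges⇒conj : ∀ {u} → IncEdge B g u false → IncEdge B g u true → label u ≡ conj
  IncEdges⇒conj (inj₁ u-conj , _) _ = u-conj
  IncEdges⇒conj (kf@(inj₂ (x , ux , _)) , inc) (kt , _) with inc (x , ux)
  ... | y , uy , c , gy with kept-bit uy gy kf | kept-bit uy gy kt
  ... | refl | ()

  incPaths-coincide : IsAndFBDD B → ∀ {u w₁ w₂ x}
    (p : IncPath B g u w₁) (q : IncPath B g u w₂) → Complete B g w₁ → Complete B g w₂ →
    VarOf B ∅ w₁ x → VarOf B ∅ w₂ x →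
    _≡_ {A = Σ (Node B) (Walk B u)} (w₁ , proj₁ p) (w₂ , proj₁ q)
  incPaths-coincide fbdd ([] , _) ([] , _) _ _ _ _ = refl
  incPaths-coincide fbdd ([] , _) (step _ _ _ , e , _) w₁-comp _ _ _ =
    ⊥-elim (complete⇒¬IncEdge w₁-comp e)
  incPaths-coincide fbdd (step _ _ _ , e , _) ([] , _) _ w₂-comp _ _ =
    ⊥-elim (complete⇒¬IncEdge w₂-comp e)
  incPaths-coincide fbdd (step u false p , _ , ip) (step _ false q , _ , iq) c₁ c₂ x₁ x₂ =
    cong (λ (w , r) → w , step u false r) (incPaths-coincide fbdd (p , ip) (q , iq) c₁ c₂ x₁ x₂)
  incPaths-coincide fbdd (step u true p , _ , ip) (step _ true q , _ , iq) c₁ c₂ x₁ x₂ =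
    cong (λ (w , r) → w , step u true r) (incPaths-coincide fbdd (p , ip) (q , iq) c₁ c₂ x₁ x₂)
  incPaths-coincide fbdd (step u false p , ef , ip) (step _ true q , et , iq) _ _ x₁ x₂ =
    ⊥-elim (IsAndFBDD.decomposable fbdd u (IncEdges⇒conj ef et) _
      (VarOf∅-extend (IncPath⇒Path∅ (p , ip)) x₁) (VarOf∅-extend (IncPath⇒Path∅ (q , iq)) x₂))
  incPaths-coincide fbdd (step u true p , et , ip) (step _ false q , ef , iq) _ _ x₁ x₂ =
    ⊥-elim (IsAndFBDD.decomposable fbdd u (IncEdges⇒conj ef et) _
      (VarOf∅-extend (IncPath⇒Path∅ (q , iq)) x₂) (VarOf∅-extend (IncPath⇒Path∅ (p , ip)) x₁))

  complete-reach : ∀ {π u v} → Obeys B π → DomIsPrefix π g →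
                   Complete B g u → Path B g u v → IsDec B v → Complete B g v
  complete-reach _  _   u-comp ([] , _) _ = u-comp
  complete-reach ob dom (x , ux , gx) (step u b p , k , kp) (y , vy) with g y in gy
  ... | nothing = y , vy , gy
  ... | just c with dom-downClosed (Obeys.π-linear ob) dom
                      (Obeys.ordered ob _ _ x y ux vy (b , Kept⇒Kept∅ k , Path⇒Path∅ (p , kp)))
                      (c , gy)
  ...   | _ , gx′ with trans (sym gx) gx′
  ...     | ()

  L-disjoint : IsAndFBDD B → ∀ u₁ u₂ → InL B g u₁ → InL B g u₂ → u₁ ≢ u₂ →
               ∀ x → VarOf B g u₁ x → VarOf B g u₂ x → ⊥
  L-disjoint fbdd u₁ u₂ (c₁ , p) (c₂ , q) u₁≢u₂ x x₁ x₂ =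
    u₁≢u₂ (cong proj₁ (incPaths-coincide fbdd p q c₁ c₂ (VarOf⇒VarOf∅ x₁) (VarOf⇒VarOf∅ x₂)))

  TEdge⇒IncEdge : ∀ {a c} → TEdge B g a c → IncEdge B g a c
  TEdge⇒IncEdge (_ , _ , (p , ip) , e) = EdgeOn⇒AllEdges p e ip

  T-rootedTree : IsAndFBDD B → IsRootedTree B g
  T-rootedTree fbdd v (w , w∈L@(w-comp@(y , wy , _) , _) , (P , iP) , v∈P)
    with splitAt-NodeOn P v∈P iP
  ... | (r , r⊆P) , (s , is) = (r , AllEdges-map (λ e → w , w∈L , (P , iP) , e) r r⊆P) , unique
    where
    throughT : ∀ (p : Walk B source v) → AllEdges B (TEdge B g) p → IncPath B g source w
    throughT p tp = p ++ᵂ s , AllEdges-++ p (AllEdges-map TEdge⇒IncEdge p tp) is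

    unique : ∀ p q → AllEdges B (TEdge B g) p → AllEdges B (TEdge B g) q → p ≡ q
    unique p q tp tq = ++ᵂ-cancelʳ p q s
      (,-injectiveʳ-UIP (Decidable⇒UIP.≡-irrelevant _≟_)
        (incPaths-coincide fbdd (throughT p tp) (throughT q tq) w-comp w-comp w-var w-var))
      where w-var = w , ([] , tt) , wy

lemma2 : (B : Diagram) (π : List Var) → IsAndFBDD B → Obeys B π →
         (g : Assignment) → DomIsPrefix π g →
         (∀ u v → InAlign B g u → Complete B g u → Path B g u v → IsDec B v → Complete B g v)
         × (∀ u₁ u₂ → InL B g u₁ → InL B g u₂ → u₁ ≢ u₂ →
              ∀ x → VarOf B g u₁ x → VarOf B g u₂ x → ⊥)
         × IsRootedTree B g
lemma2 B π fbdd ob g dom =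
  (λ u v _ → complete-reach ob dom) , L-disjoint fbdd , T-rootedTree fbdd
  where open Alignment B g
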